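{- No finite subset of the set of Fibonacci numbers $\{0, 1, 2, 3, 5, 8, 13, \dots\}$ is an MSTD set.
   Context: The Fibonacci numbers are $F_0=0$, $F_1=F_2=1$, $F_{n}=F_{n-1}+F_{n-2}$; their set of values is $\{0,1,2,3,5,8,\dots\}$. For a finite set $S$ of integers, $S+S = \{s+s' : s,s' \in S\}$ and $S-S = \{s-s' : s,s'\in S\}$; $S$ is an MSTD (More Sums Than Differences) set if $|S+S| > |S-S|$. -}

module Defs where

open import Data.Nat using (ℕ; zero; suc; _+_; _<_)
import Data.Nat as ℕ
open import Data.Integer using (ℤ) renaming (_-_ to _-ℤ_; +_ to ⁺_)
import Data.Integer as ℤ
open import Data.List using (List; length; deduplicate; concatMap; map)
open import Data.Product using (∃)
open import Relation.Binary.PropositionalEquality using (_≡_)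
open import Relation.Binary.Core using (Rel)
open import Relation.Binary.Definitions using (DecidableEquality)

fib : ℕ → ℕ
fib zero = 0
fib (suc zero) = 1
fib (suc (suc n)) = fib (suc n) + fib n

IsFib : ℕ → Set
IsFib x = ∃ λ n → fib n ≡ x

-- A finite set of integers is represented by a list (duplicates allowed,
-- the set is the set of its entries). Elements live in ℕ here since all
-- Fibonacci numbers are natural numbers; differences are taken in ℤ.

card : {A : Set} → DecidableEquality A → List A → ℕ
card _≟_ xs = length (deduplicate _≟_ xs)

sumSet : List ℕ → List ℤ
sumSet S = concatMap (λ s → map (λ s' → (⁺ s) ℤ.+ (⁺ s')) S) S

diffSet : List ℕ → List ℤ
diffSet S = concatMap (λ s → map (λ s' → (⁺ s) -ℤ (⁺ s')) S) S

MSTD : List ℕ → Set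
MSTD S = card ℤ._≟_ (diffSet S) < card ℤ._≟_ (sumSet S)

module Submission where

-- Induct on the largest element m = a + b, where b < a are the two preceding Fibonacci
-- numbers, so that the rest T lies in [0, a] and has no element strictly between b and a.
-- Adjoining m creates at most |T| + 1 new sums m + z, and two new differences ±(m - s) for
-- every s ∈ T with m - s ∉ T - T.  An equation m - s = x - y forces s ∈ {a, b}, and it also
-- makes m + y = x + s an old sum.  Counting shows that adjoining m adds at least as many
-- differences as sums, except for T = {0, b, a}, which is checked directly, as is the base
-- case T ⊆ {0, 1, 2, 3}.

open import Defs
open import Data.Bool using (true; false)
open import Data.Empty using (⊥-elim)
open import Data.Integer as ℤ using (ℤ; +_; +<+)
  renaming (_+_ to _+ℤ_; _-_ to _-ℤ_; _<_ to _<ℤ_)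
import Data.Integer.Properties as ℤ
open import Data.Integer.Tactic.RingSolver using (solve-∀)
open import Data.List
  using (List; []; _∷_; _++_; length; map; filter; deduplicate; concatMap; cartesianProductWith; upTo)
open import Data.List.Properties using (filter-notAll; length-++; length-map)
open import Data.List.Relation.Unary.All as All using (All; []; _∷_; all?)
open import Data.List.Relation.Unary.All.Properties using (¬All⇒Any¬)
open import Data.List.Relation.Unary.Any using (here; there)
open import Data.List.Relation.Unary.Linked using (Linked; [-]; _∷_)
open import Data.List.Relation.Unary.Linked.Properties using (Linked⇒AllPairs)
import Data.List.Relation.Unary.AllPairs as AllPairs
open import Data.List.Relation.Unary.Unique.Propositional using (Unique; []; _∷_)
import Data.List.Relation.Unary.Unique.Propositional.Properties as Unique
open import Data.List.Relation.Unary.Unique.DecPropositional.Properties using (deduplicate-!)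
open import Data.List.Membership.Propositional using (_∈_; _∉_; find; lose)
open import Data.List.Membership.Propositional.Properties
import Data.List.Membership.DecPropositional as DecMembership
open import Data.List.Relation.Binary.Subset.Propositional using (_⊆_)
open import Data.List.Relation.Binary.Subset.Propositional.Properties using (∷⁺ʳ; ∈-∷⁺ʳ)
open import Data.List.Extrema.Nat using (max; xs≤max)
open import Data.Nat as ℕ using (ℕ; zero; suc; _+_; _≤_; _<_; _≤?_; z≤n; s≤s)
open import Data.Nat.Properties
open import Data.Product using (∃; ∃₂; _×_; _,_; proj₁; proj₂)
open import Data.Sum using (_⊎_; inj₁; inj₂; [_,_])
open import Function using (_∘_)
open import Relation.Binary.Definitions using (DecidableEquality)
open import Relation.Binary.PropositionalEquality
  using (_≡_; _≢_; refl; sym; trans; cong; cong₂; subst; subst₂; module ≡-Reasoning)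
open import Relation.Nullary using (¬_; ¬?; Dec; does; yes; no; _×-dec_)
open import Relation.Nullary.Decidable using (toWitness)

module _ {A : Set} (_≟_ : DecidableEquality A) where

  remove : A → List A → List A
  remove x = filter (¬? ∘ (x ≟_))

  ∈-remove⁺ : ∀ {x y xs} → y ∈ xs → x ≢ y → y ∈ remove x xs
  ∈-remove⁺ {x} = ∈-filter⁺ (¬? ∘ (x ≟_))

  ∈-remove⁻ : ∀ {x y} xs → y ∈ remove x xs → y ∈ xs × x ≢ y
  ∈-remove⁻ {x} _ = ∈-filter⁻ (¬? ∘ (x ≟_))

  remove-! : ∀ {x xs} → Unique xs → Unique (remove x xs)
  remove-! {x} = Unique.filter⁺ (¬? ∘ (x ≟_))

  ⊆-∷-remove : ∀ {x xs} → xs ⊆ x ∷ remove x xs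
  ⊆-∷-remove {x} {xs} {y} y∈xs with x ≟ y
  ... | yes refl = here refl
  ... | no x≢y   = there (∈-remove⁺ y∈xs x≢y)

  length-remove-< : ∀ {x xs} → x ∈ xs → length (remove x xs) < length xs
  length-remove-< {x} {xs} x∈xs = filter-notAll (¬? ∘ (x ≟_)) xs (lose x∈xs λ x≢x → x≢x refl)

  Unique-⊆⇒length-≤ : {xs ys : List A} → Unique xs → xs ⊆ ys → length xs ≤ length ys
  Unique-⊆⇒length-≤ {[]}           _            _     = z≤n
  Unique-⊆⇒length-≤ {x ∷ xs} {ys} (x∉xs ∷ xs!) xs⊆ys =
    ≤-trans (s≤s (Unique-⊆⇒length-≤ xs! xs⊆ys∖x)) (length-remove-< (xs⊆ys (here refl)))
    where
    xs⊆ys∖x : xs ⊆ remove x ys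
    xs⊆ys∖x y∈xs = ∈-remove⁺ (xs⊆ys (there y∈xs)) (All.lookup x∉xs y∈xs)

  length-remove : ∀ {x xs} → Unique xs → x ∈ xs → length xs ≡ suc (length (remove x xs))
  length-remove xs! x∈xs = ≤-antisym (Unique-⊆⇒length-≤ xs! ⊆-∷-remove) (length-remove-< x∈xs)

  ≡[]⊎0<length : (xs : List A) → xs ≡ [] ⊎ 0 < length xs
  ≡[]⊎0<length []      = inj₁ refl
  ≡[]⊎0<length (_ ∷ _) = inj₂ (s≤s z≤n)

  card-≤-length : ∀ {xs ys} → xs ⊆ ys → card _≟_ xs ≤ length ys
  card-≤-length {xs} xs⊆ys =
    Unique-⊆⇒length-≤ (deduplicate-! _≟_ xs) (xs⊆ys ∘ ∈-deduplicate⁻ _≟_ xs)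

  length-≤-card : ∀ {xs ys} → Unique ys → ys ⊆ xs → length ys ≤ card _≟_ xs
  length-≤-card ys! ys⊆xs = Unique-⊆⇒length-≤ ys! (∈-deduplicate⁺ _≟_ ∘ ys⊆xs)

  card-mono : ∀ {xs ys} → xs ⊆ ys → card _≟_ xs ≤ card _≟_ ys
  card-mono xs⊆ys = card-≤-length (∈-deduplicate⁺ _≟_ ∘ xs⊆ys)

concatMap-map≡cartesianProductWith : {A B C : Set} (f : A → B → C) (xs : List A) (ys : List B) →
  concatMap (λ x → map (f x) ys) xs ≡ cartesianProductWith f xs ys
concatMap-map≡cartesianProductWith f []       ys = refl
concatMap-map≡cartesianProductWith f (x ∷ xs) ys =
  cong (map (f x) ys ++_) (concatMap-map≡cartesianProductWith f xs ys)

private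
  cardℤ : List ℤ → ℕ
  cardℤ = card ℤ._≟_

  _∈ℕ?_ : ∀ x xs → Dec (x ∈ xs)
  _∈ℕ?_ = DecMembership._∈?_ ℕ._≟_

SumsAtMostDiffs : List ℕ → Set
SumsAtMostDiffs S = cardℤ (sumSet S) ≤ cardℤ (diffSet S)

module _ {S : List ℕ} where

  ∈-sumSet⁺ : ∀ {s s'} → s ∈ S → s' ∈ S → + (s + s') ∈ sumSet S
  ∈-sumSet⁺ s∈S s'∈S = subst (_ ∈_) (sym (concatMap-map≡cartesianProductWith _ S S))
    (∈-cartesianProductWith⁺ (λ s s' → + s +ℤ + s') s∈S s'∈S)

  ∈-sumSet⁻ : ∀ {z} → z ∈ sumSet S → ∃₂ λ s s' → s ∈ S × s' ∈ S × z ≡ + (s + s')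
  ∈-sumSet⁻ z∈S+S = ∈-cartesianProductWith⁻ (λ s s' → + s +ℤ + s') S S
    (subst (_ ∈_) (concatMap-map≡cartesianProductWith _ S S) z∈S+S)

  ∈-diffSet⁺ : ∀ {s s'} → s ∈ S → s' ∈ S → + s -ℤ + s' ∈ diffSet S
  ∈-diffSet⁺ s∈S s'∈S = subst (_ ∈_) (sym (concatMap-map≡cartesianProductWith _ S S))
    (∈-cartesianProductWith⁺ (λ s s' → + s -ℤ + s') s∈S s'∈S)

  ∈-diffSet⁻ : ∀ {z} → z ∈ diffSet S → ∃₂ λ s s' → s ∈ S × s' ∈ S × z ≡ + s -ℤ + s'
  ∈-diffSet⁻ z∈S-S = ∈-cartesianProductWith⁻ (λ s s' → + s -ℤ + s') S S
    (subst (_ ∈_) (concatMap-map≡cartesianProductWith _ S S) z∈S-S)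

sumSet-mono : ∀ {S S'} → S ⊆ S' → sumSet S ⊆ sumSet S'
sumSet-mono {S} S⊆S' z∈S+S with ∈-sumSet⁻ {S} z∈S+S
... | _ , _ , s∈S , s'∈S , refl = ∈-sumSet⁺ (S⊆S' s∈S) (S⊆S' s'∈S)

diffSet-mono : ∀ {S S'} → S ⊆ S' → diffSet S ⊆ diffSet S'
diffSet-mono {S} S⊆S' z∈S-S with ∈-diffSet⁻ {S} z∈S-S
... | _ , _ , s∈S , s'∈S , refl = ∈-diffSet⁺ (S⊆S' s∈S) (S⊆S' s'∈S)

SumsAtMostDiffs-resp-⊆⊇ : ∀ {S S'} → S ⊆ S' → S' ⊆ S → SumsAtMostDiffs S' → SumsAtMostDiffs S
SumsAtMostDiffs-resp-⊆⊇ {S} {S'} S⊆S' S'⊆S S'+S'≤S'-S' =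
  ≤-trans (card-mono ℤ._≟_ (sumSet-mono {S} S⊆S'))
          (≤-trans S'+S'≤S'-S' (card-mono ℤ._≟_ (diffSet-mono {S'} S'⊆S)))

module _ where
  private
    shift : ∀ x y c → x -ℤ y ≡ (x +ℤ c) -ℤ (y +ℤ c)
    shift = solve-∀

    split : ∀ x y w → x +ℤ w ≡ (x -ℤ y) +ℤ (y +ℤ w)
    split = solve-∀

    shift-comm : ∀ z w y → z -ℤ w ≡ (z +ℤ y) -ℤ (y +ℤ w)
    shift-comm z w y = trans (shift z w y) (cong ((z +ℤ y) -ℤ_) (ℤ.+-comm w y))

  x-y≡z-w⇒x+w≡z+y : ∀ x y z w → x -ℤ y ≡ z -ℤ w → x +ℤ w ≡ z +ℤ y
  x-y≡z-w⇒x+w≡z+y x y z w eq = begin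
    x +ℤ w               ≡⟨ split x y w ⟩
    (x -ℤ y) +ℤ (y +ℤ w) ≡⟨ cong (_+ℤ (y +ℤ w)) eq ⟩
    (z -ℤ w) +ℤ (y +ℤ w) ≡⟨ cong ((z -ℤ w) +ℤ_) (ℤ.+-comm y w) ⟩
    (z -ℤ w) +ℤ (w +ℤ y) ≡⟨ sym (split z w y) ⟩
    z +ℤ y               ∎
    where open ≡-Reasoning

  x+w≡z+y⇒x-y≡z-w : ∀ x y z w → x +ℤ w ≡ z +ℤ y → x -ℤ y ≡ z -ℤ w
  x+w≡z+y⇒x-y≡z-w x y z w eq = begin
    x -ℤ y                   ≡⟨ shift x y w ⟩
    (x +ℤ w) -ℤ (y +ℤ w)     ≡⟨ cong (_-ℤ (y +ℤ w)) eq ⟩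
    (z +ℤ y) -ℤ (y +ℤ w)     ≡⟨ sym (shift-comm z w y) ⟩
    z -ℤ w                   ∎
    where open ≡-Reasoning

  x+w<z+y⇒x-y<z-w : ∀ x y z w → x +ℤ w <ℤ z +ℤ y → x -ℤ y <ℤ z -ℤ w
  x+w<z+y⇒x-y<z-w x y z w lt = subst₂ _<ℤ_ (sym (shift x y w)) (sym (shift-comm z w y))
    (ℤ.+-monoˡ-< (ℤ.- (y +ℤ w)) lt)

diff-≡⇒cross-≡ : ∀ p q r t → + p -ℤ + q ≡ + r -ℤ + t → p + t ≡ r + q
diff-≡⇒cross-≡ p q r t eq = ℤ.+-injective (x-y≡z-w⇒x+w≡z+y (+ p) (+ q) (+ r) (+ t) eq)

cross-≡⇒diff-≡ : ∀ p q r t → p + t ≡ r + q → + p -ℤ + q ≡ + r -ℤ + t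
cross-≡⇒diff-≡ p q r t eq = x+w≡z+y⇒x-y≡z-w (+ p) (+ q) (+ r) (+ t) (cong (+_) eq)

cross-<⇒diff-< : ∀ p q r t → p + t < r + q → + p -ℤ + q <ℤ + r -ℤ + t
cross-<⇒diff-< p q r t lt = x+w<z+y⇒x-y<z-w (+ p) (+ q) (+ r) (+ t) (+<+ lt)

∈-diffSet-neg : ∀ {S} p q → + p -ℤ + q ∈ diffSet S → + q -ℤ + p ∈ diffSet S
∈-diffSet-neg {S} p q pq∈S-S with ∈-diffSet⁻ {S} pq∈S-S
... | x , y , x∈S , y∈S , pq≡xy =
  subst (_∈ diffSet S) (cross-≡⇒diff-≡ y x q p y+p≡q+x) (∈-diffSet⁺ y∈S x∈S)
  where
  y+p≡q+x : y + p ≡ q + x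
  y+p≡q+x = trans (+-comm y p) (trans (diff-≡⇒cross-≡ p q x y pq≡xy) (+-comm x q))

module _ {m : ℕ} {T : List ℕ} where

  card-sumSet-∷-≤ : (E : List ℕ) → (∀ {z} → z ∈ m ∷ T → z ∈ E ⊎ + (m + z) ∈ sumSet T) →
                    cardℤ (sumSet (m ∷ T)) ≤ cardℤ (sumSet T) + length E
  card-sumSet-∷-≤ E cover = begin
    cardℤ (sumSet (m ∷ T))        ≤⟨ card-≤-length ℤ._≟_ sumSet-∷⊆ ⟩
    length (old ++ new)           ≡⟨ length-++ old ⟩
    cardℤ (sumSet T) + length new ≡⟨ cong (cardℤ (sumSet T) ℕ.+_) (length-map _ E) ⟩
    cardℤ (sumSet T) + length E   ∎
    where
    open ≤-Reasoning
    old = deduplicate ℤ._≟_ (sumSet T)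
    new = map (λ z → + (m + z)) E

    m+z∈ : ∀ {z} → z ∈ m ∷ T → + (m + z) ∈ old ++ new
    m+z∈ z∈m∷T with cover z∈m∷T
    ... | inj₁ z∈E    = ∈-++⁺ʳ old (∈-map⁺ _ z∈E)
    ... | inj₂ m+z∈T+T = ∈-++⁺ˡ (∈-deduplicate⁺ ℤ._≟_ m+z∈T+T)

    sumSet-∷⊆ : sumSet (m ∷ T) ⊆ old ++ new
    sumSet-∷⊆ z∈ with ∈-sumSet⁻ {m ∷ T} z∈
    ... | _ , _ , here refl , s'∈ , refl = m+z∈ s'∈
    ... | s , _ , there s∈T , here refl , refl =
      subst (λ n → + n ∈ old ++ new) (+-comm m s) (m+z∈ (there s∈T))
    ... | _ , _ , there s∈T , there s'∈T , refl =
      ∈-++⁺ˡ (∈-deduplicate⁺ ℤ._≟_ (∈-sumSet⁺ s∈T s'∈T))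

  card-diffSet-∷-≥ : All (_< m) T → {R : List ℕ} → Unique R → R ⊆ T →
                     (∀ {s} → s ∈ R → + m -ℤ + s ∉ diffSet T) →
                     cardℤ (diffSet T) + (length R + length R) ≤ cardℤ (diffSet (m ∷ T))
  card-diffSet-∷-≥ T<m {R} R! R⊆T new = begin
    cardℤ (diffSet T) + (length R + length R) ≡⟨ sym length-old++above++below ⟩
    length (old ++ above ++ below)            ≤⟨ length-≤-card ℤ._≟_ unique ⊆diffSet-∷ ⟩
    cardℤ (diffSet (m ∷ T))                   ∎
    where
    open ≤-Reasoning
    old = deduplicate ℤ._≟_ (diffSet T)
    above = map (λ s → + m -ℤ + s) R
    below = map (λ s → + s -ℤ + m) R

    length-old++above++below : length (old ++ above ++ below) ≡ cardℤ (diffSet T) + (length R + length R)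
    length-old++above++below = trans (length-++ old) (cong (cardℤ (diffSet T) ℕ.+_)
      (trans (length-++ above) (cong₂ _+_ (length-map _ R) (length-map _ R))))

    above-injective : ∀ {x y} → + m -ℤ + x ≡ + m -ℤ + y → x ≡ y
    above-injective {x} {y} eq = sym (+-cancelˡ-≡ m y x (diff-≡⇒cross-≡ m x m y eq))

    below-injective : ∀ {x y} → + x -ℤ + m ≡ + y -ℤ + m → x ≡ y
    below-injective {x} {y} eq = +-cancelʳ-≡ m x y (diff-≡⇒cross-≡ x m y m eq)

    above∩below≡∅ : ∀ {v} → ¬ (v ∈ above × v ∈ below)
    above∩below≡∅ (v∈above , v∈below) with ∈-map⁻ _ v∈above | ∈-map⁻ _ v∈below
    ... | s , s∈R , refl | s' , s'∈R , eq = <-irrefl (sym (diff-≡⇒cross-≡ m s s' m eq))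
      (+-mono-< (All.lookup T<m (R⊆T s'∈R)) (All.lookup T<m (R⊆T s∈R)))

    old∩new≡∅ : ∀ {v} → ¬ (v ∈ old × v ∈ above ++ below)
    old∩new≡∅ (v∈old , v∈new) with ∈-++⁻ above v∈new
    ... | inj₁ v∈above with ∈-map⁻ _ v∈above
    ...   | s , s∈R , refl = new s∈R (∈-deduplicate⁻ ℤ._≟_ _ v∈old)
    old∩new≡∅ (v∈old , _) | inj₂ v∈below with ∈-map⁻ _ v∈below
    ...   | s , s∈R , refl = new s∈R (∈-diffSet-neg {T} s m (∈-deduplicate⁻ ℤ._≟_ _ v∈old))

    unique : Unique (old ++ above ++ below)
    unique = Unique.++⁺ (deduplicate-! ℤ._≟_ (diffSet T))
      (Unique.++⁺ (Unique.map⁺ above-injective R!) (Unique.map⁺ below-injective R!) above∩below≡∅)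
      old∩new≡∅

    ⊆diffSet-∷ : old ++ above ++ below ⊆ diffSet (m ∷ T)
    ⊆diffSet-∷ v∈ with ∈-++⁻ old v∈
    ... | inj₁ v∈old = diffSet-mono {T} there (∈-deduplicate⁻ ℤ._≟_ _ v∈old)
    ... | inj₂ v∈new with ∈-++⁻ above v∈new
    ...   | inj₁ v∈above with ∈-map⁻ _ v∈above
    ...     | s , s∈R , refl = ∈-diffSet⁺ {m ∷ T} (here refl) (there (R⊆T s∈R))
    ⊆diffSet-∷ v∈ | inj₂ v∈new | inj₂ v∈below with ∈-map⁻ _ v∈below
    ...     | s , s∈R , refl = ∈-diffSet⁺ {m ∷ T} (there (R⊆T s∈R)) (here refl)

  SumsAtMostDiffs-∷ : All (_< m) T → (E R : List ℕ) → Unique R → R ⊆ T →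
                      (∀ {s} → s ∈ R → + m -ℤ + s ∉ diffSet T) →
                      (∀ {z} → z ∈ m ∷ T → z ∈ E ⊎ + (m + z) ∈ sumSet T) →
                      length E ≤ length R + length R →
                      SumsAtMostDiffs T → SumsAtMostDiffs (m ∷ T)
  SumsAtMostDiffs-∷ T<m E R R! R⊆T new cover |E|≤2|R| T+T≤T-T = begin
    cardℤ (sumSet (m ∷ T))                    ≤⟨ card-sumSet-∷-≤ E cover ⟩
    cardℤ (sumSet T) + length E               ≤⟨ +-mono-≤ T+T≤T-T |E|≤2|R| ⟩
    cardℤ (diffSet T) + (length R + length R) ≤⟨ card-diffSet-∷-≥ T<m R! R⊆T new ⟩
    cardℤ (diffSet (m ∷ T))                   ∎
    where open ≤-Reasoning

card-sumSet-∷-≤-suc-length : ∀ x S → cardℤ (sumSet (x ∷ S)) ≤ cardℤ (sumSet S) + suc (length S)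
card-sumSet-∷-≤-suc-length x S = card-sumSet-∷-≤ (x ∷ S) inj₁

n<m<n+n⇒0<n : ∀ {m n} → n < m → m < n + n → 0 < n
n<m<n+n⇒0<n {m} {n} n<m m<n+n =
  +-cancelˡ-< n 0 n (subst (_< n + n) (sym (+-identityʳ n)) (<-trans n<m m<n+n))

SumsAtMostDiffs-[a+b,0,a,b] : ∀ {a b} → b < a → a < b + b → SumsAtMostDiffs (a + b ∷ 0 ∷ a ∷ b ∷ [])
SumsAtMostDiffs-[a+b,0,a,b] {a} {b} b<a a<2b = begin
  cardℤ (sumSet (m ∷ T))              ≤⟨ card-sumSet-∷-≤ (m ∷ a ∷ b ∷ []) cover ⟩
  cardℤ (sumSet T) + 3                ≤⟨ +-monoˡ-≤ 3 (card-sumSet-∷-≤-suc-length 0 (a ∷ b ∷ [])) ⟩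
  cardℤ (sumSet (a ∷ b ∷ [])) + 3 + 3 ≤⟨ +-monoˡ-≤ 3 (+-monoˡ-≤ 3 (card-sumSet-∷-≤-suc-length a (b ∷ []))) ⟩
  9                                   ≡⟨⟩
  length differences                  ≤⟨ length-≤-card ℤ._≟_ differences-! differences⊆ ⟩
  cardℤ (diffSet (m ∷ T))             ∎
  where
  open ≤-Reasoning
  m = a + b
  T = 0 ∷ a ∷ b ∷ []

  cover : ∀ {z} → z ∈ m ∷ T → z ∈ m ∷ a ∷ b ∷ [] ⊎ + (m + z) ∈ sumSet T
  cover (here refl)                         = inj₁ (here refl)
  cover (there (here refl))                 = inj₂ (subst (λ n → + n ∈ sumSet T) (sym (+-identityʳ m))
                                                      (∈-sumSet⁺ {T} (there (here refl)) (there (there (here refl)))))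
  cover (there (there (here refl)))         = inj₁ (there (here refl))
  cover (there (there (there (here refl)))) = inj₁ (there (there (here refl)))

  d : ℕ → ℕ → ℤ
  d p q = + p -ℤ + q

  differences : List ℤ
  differences = d 0 m ∷ d 0 a ∷ d 0 b ∷ d b a ∷ d 0 0 ∷ d a b ∷ d b 0 ∷ d a 0 ∷ d m 0 ∷ []

  a<m : a < m
  a<m = m<m+n a (n<m<n+n⇒0<n b<a a<2b)

  x<y⇒x+0<y+0 : ∀ {x y} → x < y → x + 0 < y + 0
  x<y⇒x+0<y+0 {x} {y} = subst₂ _<_ (sym (+-identityʳ x)) (sym (+-identityʳ y))

  increasing : Linked _<ℤ_ differences
  increasing = cross-<⇒diff-< 0 m 0 a a<m
             ∷ cross-<⇒diff-< 0 a 0 b b<a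
             ∷ cross-<⇒diff-< 0 b b a a<2b
             ∷ cross-<⇒diff-< b a 0 0 (subst (_< a) (sym (+-identityʳ b)) b<a)
             ∷ cross-<⇒diff-< 0 0 a b (subst (b <_) (sym (+-identityʳ a)) b<a)
             ∷ cross-<⇒diff-< a b b 0 (subst (_< b + b) (sym (+-identityʳ a)) a<2b)
             ∷ cross-<⇒diff-< b 0 a 0 (x<y⇒x+0<y+0 b<a)
             ∷ cross-<⇒diff-< a 0 m 0 (x<y⇒x+0<y+0 a<m)
             ∷ [-]

  differences-! : Unique differences
  differences-! = AllPairs.map ℤ.<⇒≢ (Linked⇒AllPairs ℤ.<-trans increasing)

  m∈ : m ∈ m ∷ T
  m∈ = here refl
  0∈ : 0 ∈ m ∷ T
  0∈ = there (here refl)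
  a∈ : a ∈ m ∷ T
  a∈ = there (there (here refl))
  b∈ : b ∈ m ∷ T
  b∈ = there (there (there (here refl)))

  differences⊆ : differences ⊆ diffSet (m ∷ T)
  differences⊆ = All.lookup (d∈ 0∈ m∈ ∷ d∈ 0∈ a∈ ∷ d∈ 0∈ b∈ ∷ d∈ b∈ a∈ ∷ d∈ 0∈ 0∈
                           ∷ d∈ a∈ b∈ ∷ d∈ b∈ 0∈ ∷ d∈ a∈ 0∈ ∷ d∈ m∈ 0∈ ∷ [])
    where
    d∈ : ∀ {p q} → p ∈ m ∷ T → q ∈ m ∷ T → d p q ∈ diffSet (m ∷ T)
    d∈ = ∈-diffSet⁺ {m ∷ T}

module _ {a b : ℕ} (b<a : b < a) (a<2b : a < b + b)
         {T : List ℕ} (T! : Unique T) (T≤a : All (_≤ a) T) (gap : All (λ x → x < a → x ≤ b) T) where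

  private
    m : ℕ
    m = a + b

    T<m : All (_< m) T
    T<m = All.map (λ x≤a → ≤-<-trans x≤a (m<m+n a (n<m<n+n⇒0<n b<a a<2b))) T≤a

    Collides : ℕ → Set
    Collides s = + m -ℤ + s ∈ diffSet T

    collides? : ∀ s → Dec (Collides s)
    collides? s = DecMembership._∈?_ ℤ._≟_ (+ m -ℤ + s) (diffSet T)

    nonColliding : List ℕ
    nonColliding = filter (¬? ∘ collides?) T

    ∈-nonColliding⁺ : ∀ {s} → s ∈ T → ¬ Collides s → s ∈ nonColliding
    ∈-nonColliding⁺ = ∈-filter⁺ (¬? ∘ collides?)

    ∈-nonColliding⁻ : ∀ {s} → s ∈ nonColliding → s ∈ T × ¬ Collides s
    ∈-nonColliding⁻ = ∈-filter⁻ (¬? ∘ collides?)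

    collides⇒crossing : ∀ {s} → Collides s → ∃₂ λ x y → x ∈ T × y ∈ T × m + y ≡ x + s
    collides⇒crossing {s} c with ∈-diffSet⁻ {T} c
    ... | x , y , x∈T , y∈T , eq = x , y , x∈T , y∈T , diff-≡⇒cross-≡ m s x y eq

    collides⇒≡a⊎≡b : ∀ {s} → s ∈ T → Collides s → s ≡ a ⊎ s ≡ b
    collides⇒≡a⊎≡b {s} s∈T c with collides⇒crossing c
    ... | x , y , x∈T , _ , eq with m≤n⇒m<n∨m≡n (All.lookup T≤a s∈T)
    ...   | inj₂ s≡a = inj₁ s≡a
    ...   | inj₁ s<a = inj₂ (≤-antisym (All.lookup gap s∈T s<a) (+-cancelˡ-≤ a b s a+b≤a+s))
      where
      a+b≤a+s : a + b ≤ a + s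
      a+b≤a+s = begin
        a + b     ≤⟨ m≤m+n m y ⟩
        m + y     ≡⟨ eq ⟩
        x + s     ≤⟨ +-monoˡ-≤ s (All.lookup T≤a x∈T) ⟩
        a + s     ∎
        where open ≤-Reasoning

    collides⇒oldSum : ∀ {s} → s ∈ T → Collides s → ∃ λ y → y ∈ T × y ≢ s × + (m + y) ∈ sumSet T
    collides⇒oldSum {s} s∈T c with collides⇒crossing c
    ... | x , y , x∈T , y∈T , eq =
      y , y∈T , y≢s , subst (λ n → + n ∈ sumSet T) (sym eq) (∈-sumSet⁺ {T} x∈T s∈T)
      where
      y≢s : y ≢ s
      y≢s refl = <-irrefl (sym (+-cancelʳ-≡ s m x eq)) (All.lookup T<m x∈T)

    b-collides⇒0∈T : Collides b → 0 ∈ T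
    b-collides⇒0∈T c with collides⇒crossing c
    ... | x , y , x∈T , y∈T , eq = subst (_∈ T) (n≤0⇒n≡0 (+-cancelˡ-≤ a y 0 a+y≤a+0)) y∈T
      where
      a+y≡x : a + y ≡ x
      a+y≡x = +-cancelʳ-≡ b (a + y) x (begin
        a + y + b   ≡⟨ +-assoc a y b ⟩
        a + (y + b) ≡⟨ cong (a ℕ.+_) (+-comm y b) ⟩
        a + (b + y) ≡⟨ sym (+-assoc a b y) ⟩
        m + y       ≡⟨ eq ⟩
        x + b       ∎)
        where open ≡-Reasoning
      a+y≤a+0 : a + y ≤ a + 0
      a+y≤a+0 = subst₂ _≤_ (sym a+y≡x) (sym (+-identityʳ a)) (All.lookup T≤a x∈T)

    length-T≤ : (C : List ℕ) → (∀ {s} → s ∈ T → Collides s → s ∈ C) →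
                length T ≤ length C + length nonColliding
    length-T≤ C collisions⊆C = begin
      length T                            ≤⟨ Unique-⊆⇒length-≤ ℕ._≟_ T! T⊆C++R ⟩
      length (C ++ nonColliding)          ≡⟨ length-++ C ⟩
      length C + length nonColliding      ∎
      where
      open ≤-Reasoning
      T⊆C++R : T ⊆ C ++ nonColliding
      T⊆C++R {s} s∈T with collides? s
      ... | yes c = ∈-++⁺ˡ (collisions⊆C s∈T c)
      ... | no ¬c = ∈-++⁺ʳ C (∈-nonColliding⁺ s∈T ¬c)

    extend : (E : List ℕ) → (∀ {z} → z ∈ m ∷ T → z ∈ E ⊎ + (m + z) ∈ sumSet T) →
             length E ≤ length nonColliding + length nonColliding →
             SumsAtMostDiffs T → SumsAtMostDiffs (m ∷ T)
    extend E = SumsAtMostDiffs-∷ T<m E nonColliding (Unique.filter⁺ (¬? ∘ collides?) T!)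
      (proj₁ ∘ ∈-nonColliding⁻) (proj₂ ∘ ∈-nonColliding⁻)

    noCollision : (∀ {s} → s ∈ T → ¬ Collides s) → SumsAtMostDiffs T → SumsAtMostDiffs (m ∷ T)
    noCollision none T+T≤T-T with ≡[]⊎0<length ℕ._≟_ T
    ... | inj₁ T≡[]  = subst (λ X → SumsAtMostDiffs (m ∷ X)) (sym T≡[]) ≤-refl
    ... | inj₂ 0<|T| = extend (m ∷ T) inj₁
        (≤-trans (s≤s |T|≤|R|) (+-monoˡ-≤ (length nonColliding) (≤-trans 0<|T| |T|≤|R|))) T+T≤T-T
      where
      |T|≤|R| : length T ≤ length nonColliding
      |T|≤|R| = length-T≤ [] (λ s∈T c → ⊥-elim (none s∈T c))

    oneCollision : ∀ {s} → s ∈ T → Collides s → (∀ {s'} → s' ∈ T → Collides s' → s' ≡ s) →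
                   SumsAtMostDiffs T → SumsAtMostDiffs (m ∷ T)
    oneCollision {s} s∈T c only-s T+T≤T-T with collides⇒oldSum s∈T c
    ... | y , y∈T , y≢s , m+y∈T+T = extend (m ∷ remove ℕ._≟_ y T) cover |E|≤2|R| T+T≤T-T
      where
      R = nonColliding
      cover : ∀ {z} → z ∈ m ∷ T → z ∈ m ∷ remove ℕ._≟_ y T ⊎ + (m + z) ∈ sumSet T
      cover (here refl) = inj₁ (here refl)
      cover {z} (there z∈T) with y ℕ.≟ z
      ... | yes refl = inj₂ m+y∈T+T
      ... | no y≢z   = inj₁ (there (∈-remove⁺ ℕ._≟_ z∈T y≢z))
      y∈R : y ∈ R
      y∈R = ∈-nonColliding⁺ y∈T (y≢s ∘ only-s y∈T)
      |E|≤2|R| : suc (length (remove ℕ._≟_ y T)) ≤ length R + length R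
      |E|≤2|R| = begin
        suc (length (remove ℕ._≟_ y T)) ≡⟨ sym (length-remove ℕ._≟_ T! y∈T) ⟩
        length T                         ≤⟨ length-T≤ (s ∷ []) (λ s'∈T c' → here (only-s s'∈T c')) ⟩
        1 + length R                     ≤⟨ +-monoˡ-≤ (length R) 1≤|R| ⟩
        length R + length R              ∎
        where
        open ≤-Reasoning
        1≤|R| : 1 ≤ length R
        1≤|R| = Unique-⊆⇒length-≤ ℕ._≟_ ([] ∷ []) (∈-∷⁺ʳ y∈R λ ())

    b-collides∧a∈T : a ∈ T → b ∈ T → Collides b → SumsAtMostDiffs T → SumsAtMostDiffs (m ∷ T)
    b-collides∧a∈T a∈T b∈T cb T+T≤T-T with all? (_∈ℕ? (0 ∷ a ∷ b ∷ [])) T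
    ... | yes T⊆[0,a,b] = SumsAtMostDiffs-resp-⊆⊇ (∷⁺ʳ m (All.lookup T⊆[0,a,b])) (∷⁺ʳ m [0,a,b]⊆T)
                            (SumsAtMostDiffs-[a+b,0,a,b] b<a a<2b)
      where
      [0,a,b]⊆T : 0 ∷ a ∷ b ∷ [] ⊆ T
      [0,a,b]⊆T = ∈-∷⁺ʳ (b-collides⇒0∈T cb) (∈-∷⁺ʳ a∈T (∈-∷⁺ʳ b∈T λ ()))
    ... | no T⊈[0,a,b] with find (¬All⇒Any¬ (_∈ℕ? (0 ∷ a ∷ b ∷ [])) T T⊈[0,a,b])
    ...   | z , z∈T , z∉[0,a,b] = extend (m ∷ remove ℕ._≟_ 0 T) cover |E|≤2|R| T+T≤T-T
      where
      R = nonColliding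
      0∈T = b-collides⇒0∈T cb

      cover : ∀ {x} → x ∈ m ∷ T → x ∈ m ∷ remove ℕ._≟_ 0 T ⊎ + (m + x) ∈ sumSet T
      cover (here refl) = inj₁ (here refl)
      cover {x} (there x∈T) with 0 ℕ.≟ x
      ... | yes refl = inj₂ (subst (λ n → + n ∈ sumSet T) (sym (+-identityʳ m)) (∈-sumSet⁺ {T} a∈T b∈T))
      ... | no 0≢x   = inj₁ (there (∈-remove⁺ ℕ._≟_ x∈T 0≢x))

      ∈R : ∀ {s} → s ∈ T → s ≢ a → s ≢ b → s ∈ R
      ∈R s∈T s≢a s≢b = ∈-nonColliding⁺ s∈T ([ s≢a , s≢b ] ∘ collides⇒≡a⊎≡b s∈T)

      0<b = n<m<n+n⇒0<n b<a a<2b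
      0∈R : 0 ∈ R
      0∈R = ∈R 0∈T (<⇒≢ (<-trans 0<b b<a)) (<⇒≢ 0<b)
      z∈R : z ∈ R
      z∈R = ∈R z∈T (z∉[0,a,b] ∘ there ∘ here) (z∉[0,a,b] ∘ there ∘ there ∘ here)

      |E|≤2|R| : suc (length (remove ℕ._≟_ 0 T)) ≤ length R + length R
      |E|≤2|R| = begin
        suc (length (remove ℕ._≟_ 0 T)) ≡⟨ sym (length-remove ℕ._≟_ T! 0∈T) ⟩
        length T                         ≤⟨ length-T≤ (a ∷ b ∷ []) collisions⊆[a,b] ⟩
        2 + length R                     ≤⟨ +-monoˡ-≤ (length R) 2≤|R| ⟩
        length R + length R              ∎
        where
        open ≤-Reasoning
        collisions⊆[a,b] : ∀ {s} → s ∈ T → Collides s → s ∈ a ∷ b ∷ []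
        collisions⊆[a,b] s∈T c with collides⇒≡a⊎≡b s∈T c
        ... | inj₁ s≡a = here s≡a
        ... | inj₂ s≡b = there (here s≡b)
        2≤|R| : 2 ≤ length R
        2≤|R| = Unique-⊆⇒length-≤ ℕ._≟_ ((0≢z ∷ []) ∷ [] ∷ []) (∈-∷⁺ʳ 0∈R (∈-∷⁺ʳ z∈R λ ()))
          where
          0≢z : 0 ≢ z
          0≢z 0≡z = z∉[0,a,b] (here (sym 0≡z))

  SumsAtMostDiffs-∷-a+b : SumsAtMostDiffs T → SumsAtMostDiffs (a + b ∷ T)
  SumsAtMostDiffs-∷-a+b with b ∈ℕ? T ×-dec collides? b
  ... | yes (b∈T , cb) with a ∈ℕ? T
  ...   | yes a∈T = b-collides∧a∈T a∈T b∈T cb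
  ...   | no  a∉T = oneCollision b∈T cb only-b
    where
    only-b : ∀ {s} → s ∈ T → Collides s → s ≡ b
    only-b s∈T c with collides⇒≡a⊎≡b s∈T c
    ... | inj₁ refl = ⊥-elim (a∉T s∈T)
    ... | inj₂ s≡b  = s≡b
  SumsAtMostDiffs-∷-a+b | no ¬b-collides with a ∈ℕ? T ×-dec collides? a
  ... | yes (a∈T , ca) = oneCollision a∈T ca only-a
    where
    only-a : ∀ {s} → s ∈ T → Collides s → s ≡ a
    only-a s∈T c with collides⇒≡a⊎≡b s∈T c
    ... | inj₁ s≡a  = s≡a
    ... | inj₂ refl = ⊥-elim (¬b-collides (s∈T , c))
  ... | no ¬a-collides = noCollision none
    where
    none : ∀ {s} → s ∈ T → ¬ Collides s
    none s∈T c with collides⇒≡a⊎≡b s∈T c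
    ... | inj₁ refl = ¬a-collides (s∈T , c)
    ... | inj₂ refl = ¬b-collides (s∈T , c)

fib≤fib[1+n] : ∀ n → fib n ≤ fib (suc n)
fib≤fib[1+n] zero    = z≤n
fib≤fib[1+n] (suc n) = m≤m+n (fib (suc n)) (fib n)

fib-mono : ∀ {i j} → i ≤ j → fib i ≤ fib j
fib-mono {j = zero}      z≤n    = z≤n
fib-mono {i} {suc j} i≤1+j with m≤n⇒m<n∨m≡n i≤1+j
... | inj₁ (s≤s i≤j) = ≤-trans (fib-mono i≤j) (fib≤fib[1+n] j)
... | inj₂ refl      = ≤-refl

0<fib[1+n] : ∀ n → 0 < fib (suc n)
0<fib[1+n] zero    = s≤s z≤n
0<fib[1+n] (suc n) = ≤-trans (0<fib[1+n] n) (m≤m+n _ _)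

fib[2+n]<fib[3+n] : ∀ n → fib (2 + n) < fib (3 + n)
fib[2+n]<fib[3+n] n = m<m+n (fib (2 + n)) (0<fib[1+n] n)

n≤fib[4+n] : ∀ n → n ≤ fib (4 + n)
n≤fib[4+n] zero    = z≤n
n≤fib[4+n] (suc n) = ≤-trans (s≤s (n≤fib[4+n] n)) (m<m+n (fib (4 + n)) (0<fib[1+n] (2 + n)))

IsFib-<-fib[1+n]⇒≤fib[n] : ∀ {x} n → IsFib x → x < fib (suc n) → x ≤ fib n
IsFib-<-fib[1+n]⇒≤fib[n] {x} n (j , refl) x<fib[1+n] with j ≤? n
... | yes j≤n = fib-mono j≤n
... | no  j≰n = ⊥-elim (<⇒≱ x<fib[1+n] (fib-mono (≰⇒> j≰n)))

sublists : {A : Set} → List A → List (List A)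
sublists []       = [] ∷ []
sublists (x ∷ xs) = map (x ∷_) (sublists xs) ++ sublists xs

filter∈sublists : {A : Set} {P : A → Set} (P? : ∀ x → Dec (P x)) (xs : List A) → filter P? xs ∈ sublists xs
filter∈sublists P? []       = here refl
filter∈sublists P? (x ∷ xs) with does (P? x)
... | true  = ∈-++⁺ˡ (∈-map⁺ (x ∷_) (filter∈sublists P? xs))
... | false = ∈-++⁺ʳ (map (x ∷_) (sublists xs)) (filter∈sublists P? xs)

SumsAtMostDiffs? : ∀ S → Dec (SumsAtMostDiffs S)
SumsAtMostDiffs? S = cardℤ (sumSet S) ≤? cardℤ (diffSet S)

SumsAtMostDiffs-≤3 : ∀ {T} → All (_≤ 3) T → SumsAtMostDiffs T
SumsAtMostDiffs-≤3 {T} T≤3 = SumsAtMostDiffs-resp-⊆⊇ T⊆S (proj₂ ∘ ∈-filter⁻ (_∈ℕ? T))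
  (All.lookup every-sublist (filter∈sublists (_∈ℕ? T) (upTo 4)))
  where
  S = filter (_∈ℕ? T) (upTo 4)
  every-sublist : All SumsAtMostDiffs (sublists (upTo 4))
  every-sublist = toWitness {a? = all? SumsAtMostDiffs? (sublists (upTo 4))} _
  T⊆S : T ⊆ S
  T⊆S x∈T = ∈-filter⁺ (_∈ℕ? T) (∈-upTo⁺ (s≤s (All.lookup T≤3 x∈T))) x∈T

-- The step needs b < a < b + b, which fails for (a , b) = (2 , 1); hence the offset 4.
SumsAtMostDiffs-fib : ∀ k {T} → Unique T → All IsFib T → All (_≤ fib (4 + k)) T → SumsAtMostDiffs T
SumsAtMostDiffs-fib zero    _  _     T≤3 = SumsAtMostDiffs-≤3 T≤3
SumsAtMostDiffs-fib (suc k) {T} T! T-fib T≤m with fib (5 + k) ∈ℕ? T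
... | no m∉T = SumsAtMostDiffs-fib k T! T-fib (All.tabulate λ x∈T →
  IsFib-<-fib[1+n]⇒≤fib[n] (4 + k) (All.lookup T-fib x∈T) (≤∧≢⇒< (All.lookup T≤m x∈T) λ { refl → m∉T x∈T }))
... | yes m∈T = SumsAtMostDiffs-resp-⊆⊇ (⊆-∷-remove ℕ._≟_) (∈-∷⁺ʳ m∈T T'⊆T)
  (SumsAtMostDiffs-∷-a+b b<a a<2b T'! T'≤a gap (SumsAtMostDiffs-fib k T'! T'-fib T'≤a))
  where
  T' = remove ℕ._≟_ (fib (5 + k)) T
  T'! = remove-! ℕ._≟_ T!
  T'⊆T : T' ⊆ T
  T'⊆T = proj₁ ∘ ∈-remove⁻ ℕ._≟_ T
  T'-fib : All IsFib T'
  T'-fib = All.tabulate (All.lookup T-fib ∘ T'⊆T)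
  b<a : fib (3 + k) < fib (4 + k)
  b<a = fib[2+n]<fib[3+n] (suc k)
  a<2b : fib (4 + k) < fib (3 + k) + fib (3 + k)
  a<2b = +-monoʳ-< (fib (3 + k)) (fib[2+n]<fib[3+n] k)
  T'≤a : All (_≤ fib (4 + k)) T'
  T'≤a = All.tabulate λ x∈T' → IsFib-<-fib[1+n]⇒≤fib[n] (4 + k) (All.lookup T-fib (T'⊆T x∈T'))
    (≤∧≢⇒< (All.lookup T≤m (T'⊆T x∈T')) (proj₂ (∈-remove⁻ ℕ._≟_ T x∈T') ∘ sym))
  gap : All (λ x → x < fib (4 + k) → x ≤ fib (3 + k)) T'
  gap = All.tabulate λ x∈T' → IsFib-<-fib[1+n]⇒≤fib[n] (3 + k) (All.lookup T-fib (T'⊆T x∈T'))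

corollary1p2 : (S : List ℕ) → All IsFib S → ¬ MSTD S
corollary1p2 S S-fib = ≤⇒≯ (SumsAtMostDiffs-resp-⊆⊇ S⊆T T⊆S (SumsAtMostDiffs-fib (max 0 S) T! T-fib T≤fib))
  where
  T = deduplicate ℕ._≟_ S
  T! = deduplicate-! ℕ._≟_ S
  S⊆T : S ⊆ T
  S⊆T = ∈-deduplicate⁺ ℕ._≟_
  T⊆S : T ⊆ S
  T⊆S = ∈-deduplicate⁻ ℕ._≟_ S
  T-fib : All IsFib T
  T-fib = All.tabulate (All.lookup S-fib ∘ T⊆S)
  T≤fib : All (_≤ fib (4 + max 0 S)) T
  T≤fib = All.tabulate λ x∈T → ≤-trans (All.lookup (xs≤max 0 S) (T⊆S x∈T)) (n≤fib[4+n] (max 0 S))
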